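{- Let $M(x,y):=x^2y^4+x^4y^2-3x^2y^2+1$ be the Motzkin polynomial. If $M(x,y)\geqslant_\# 0$, i.e., if for all $f,g\in\#\mathsf P$ the function $w\mapsto M(f(w),g(w))$ belongs to $\#\mathsf P$, then $\mathsf{UP}=\mathsf{coUP}$.
   Context: $\#\mathsf P$ is the class of functions $f:\{0,1\}^*\to\mathbb N$ such that there is a nondeterministic polynomial-time Turing machine whose number of accepting computation paths on every input $w$ equals $f(w)$. $\mathsf{UP}$ is the class of languages whose characteristic function lies in $\#\mathsf P$; $\mathsf{coUP}$ is the class of their complements. -}

module Defs where

open import Data.Nat using (ℕ; zero; suc; _+_; _*_; _^_)
open import Data.Bool using (Bool; true; false; if_then_else_; _∨_; not; T)
open import Data.Fin using (Fin; zero; suc; _≟_)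
open import Data.List using (List; []; _∷_; length; map; concatMap)
open import Data.Nat.ListAction using (sum)
open import Data.List.Relation.Unary.All using (All)
open import Data.Sum using (_⊎_)
open import Data.Product using (Σ; _×_; _,_; ∃-syntax)
open import Data.Integer as ℤ using (ℤ; +_)
open import Relation.Nullary.Decidable using (isYes)
open import Relation.Binary.PropositionalEquality using (_≡_)
open import Function.Bundles using (_⇔_)
import Data.List.Base as L

data Move : Set where
  left right stay : Move

allMoves : List Move
allMoves = left ∷ right ∷ stay ∷ []

-- Tape alphabet is Fin (3 + k): zero = blank, 1 = bit 0, 2 = bit 1, rest extra.
record NTM : Set where
  field
    Q     : ℕ
    k     : ℕ
    start : Fin Q
    acc   : Fin Q
    rej   : Fin Q
    δ     : Fin Q → Fin (3 + k) → Fin Q → Fin (3 + k) → Move → Bool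

module _ (M : NTM) where
  open NTM M

  Γ : Set
  Γ = Fin (3 + k)

  blank : Γ
  blank = zero

  encBit : Bool → Γ
  encBit false = suc zero
  encBit true  = suc (suc zero)

  -- configuration: state, tape left of head (nearest first), head symbol, tape right of head
  record Config : Set where
    constructor cfg
    field
      state : Fin Q
      lft   : List Γ
      hd    : Γ
      rgt   : List Γ

  initial : List Bool → Config
  initial []      = cfg start [] blank []
  initial (b ∷ w) = cfg start [] (encBit b) (map encBit w)

  halted : Config → Bool
  halted c = isYes (Config.state c ≟ acc) ∨ isYes (Config.state c ≟ rej)

  accepting : Config → Bool
  accepting c = isYes (Config.state c ≟ acc)

  step : Fin Q → Γ → Move → Config → Config
  step q a left  (cfg _ []      _ r) = cfg q [] blank (a ∷ r)
  step q a left  (cfg _ (x ∷ l) _ r) = cfg q l x (a ∷ r)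
  step q a right (cfg _ l _ [])      = cfg q (a ∷ l) blank []
  step q a right (cfg _ l _ (x ∷ r)) = cfg q (a ∷ l) x r
  step q a stay  (cfg _ l _ r)       = cfg q l a r

  successors : Config → List Config
  successors c =
    concatMap (λ q → concatMap (λ a → concatMap (λ m →
        if δ (Config.state c) (Config.hd c) q a m then step q a m c ∷ [] else [])
      allMoves) (L.allFin (3 + k))) (L.allFin Q)

  -- number of accepting computation paths of length ≤ t from c
  -- (a path ends when an accept/reject state is reached, or when no transition applies)
  countAcc : ℕ → Config → ℕ
  countAcc zero c = if accepting c then 1 else 0
  countAcc (suc t) c =
    if halted c then (if accepting c then 1 else 0)
    else sum (map (countAcc t) (successors c))

  HaltsWithin : ℕ → Config → Set
  HaltsWithin zero c = T (halted c)
  HaltsWithin (suc t) c = T (halted c) ⊎ All (HaltsWithin t) (successors c)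

polyBound : ℕ → ℕ → ℕ → ℕ
polyBound c d n = c * n ^ d + c

Word : Set
Word = List Bool

SharpP : (Word → ℕ) → Set
SharpP f = Σ NTM λ M → ∃[ c ] ∃[ d ] ∀ (w : Word) →
  HaltsWithin M (polyBound c d (length w)) (initial M w)
  × countAcc M (polyBound c d (length w)) (initial M w) ≡ f w

Language : Set
Language = Word → Bool

charFun : Language → Word → ℕ
charFun L w = if L w then 1 else 0

UP : Language → Set
UP L = SharpP (charFun L)

coUP : Language → Set
coUP L = UP (λ w → not (L w))

motzkin : ℤ → ℤ → ℤ
motzkin x y = x ℤ.* x ℤ.* (y ℤ.* y ℤ.* y ℤ.* y)
            ℤ.+ x ℤ.* x ℤ.* x ℤ.* x ℤ.* (y ℤ.* y)
            ℤ.- + 3 ℤ.* (x ℤ.* x) ℤ.* (y ℤ.* y)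
            ℤ.+ + 1

-- M(x,y) ≥_# 0 : for all f, g ∈ #P, w ↦ M(f w, g w) is (ℕ-valued and) in #P
MotzkinSharpNonneg : Set
MotzkinSharpNonneg = ∀ (f g : Word → ℕ) → SharpP f → SharpP g →
  Σ (Word → ℕ) λ h → SharpP h × (∀ w → + h w ≡ motzkin (+ f w) (+ g w))

UPeqCoUP : Set
UPeqCoUP = ∀ (L : Language) → UP L ⇔ coUP L

-- Substituting y = 1 collapses the Motzkin polynomial to x⁴ − 2x² + 1 = (x² − 1)²,
-- which on a bit x ∈ {0,1} equals 1 − x. Applying the hypothesis to the
-- characteristic function of L and the constant 1 (both in #P when L ∈ UP) thus
-- yields the characteristic function of the complement of L, so UP ⊆ coUP;
-- the converse inclusion follows by applying this to the complement.
{-# OPTIONS --safe #-}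
module Submission where

open import Defs
open import Data.Nat using (ℕ)
open import Data.Bool using (Bool; true; false; not; if_then_else_)
open import Data.Bool.Properties using (not-involutive)
open import Data.Fin using (zero)
open import Data.List using ([]; _∷_; length)
open import Data.Product using (_×_; _,_)
open import Data.Unit using (tt)
open import Data.Integer using (+_)
open import Data.Integer.Properties using (+-injective)
open import Function using (_∘_; const)
open import Function.Bundles using (mk⇔)
open import Relation.Binary.PropositionalEquality using (_≡_; refl; trans; cong; _≗_)

SharpP-resp-≗ : {f g : Word → ℕ} → f ≗ g → SharpP f → SharpP g
SharpP-resp-≗ f≗g (M , c , d , spec) = M , c , d , λ w →
  let halts , count≡f = spec w in halts , trans count≡f (f≗g w)

acceptImmediately : NTM
acceptImmediately = record
  { Q = 1 ; k = 0 ; start = zero ; acc = zero ; rej = zero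
  ; δ = λ _ _ _ _ _ → false }

SharpP-const1 : SharpP (const 1)
SharpP-const1 = acceptImmediately , 0 , 0 , spec
  where
  spec : ∀ w → let run = initial acceptImmediately w ; t = polyBound 0 0 (length w) in
    HaltsWithin acceptImmediately t run × countAcc acceptImmediately t run ≡ 1
  spec []      = tt , refl
  spec (_ ∷ _) = tt , refl

motzkin-bit-one : (b : Bool) →
  motzkin (+ (if b then 1 else 0)) (+ 1) ≡ + (if not b then 1 else 0)
motzkin-bit-one true  = refl
motzkin-bit-one false = refl

UP⇒coUP : MotzkinSharpNonneg → (L : Language) → UP L → coUP L
UP⇒coUP motzkin≥#0 L L∈UP =
  let h , h∈#P , h≡M = motzkin≥#0 (charFun L) (const 1) L∈UP SharpP-const1
  in SharpP-resp-≗ (λ w → +-injective (trans (h≡M w) (motzkin-bit-one (L w)))) h∈#P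

UP-not-not : (L : Language) → UP (not ∘ not ∘ L) → UP L
UP-not-not L = SharpP-resp-≗ (λ w → cong (λ b → if b then 1 else 0) (not-involutive (L w)))

corollary2p7 : MotzkinSharpNonneg → UPeqCoUP
corollary2p7 motzkin≥#0 L = mk⇔
  (UP⇒coUP motzkin≥#0 L)
  (UP-not-not L ∘ UP⇒coUP motzkin≥#0 (not ∘ L))
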